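{- Consider Online Bin Packing with Estimated Item Sizes with any accuracy $\delta\in(0,1]$, restricted to input lists $L$ in which no three items fit together into one bin (the sum of the actual sizes of any three items exceeds $1$). On this class of inputs, the algorithm Delayed-Best-Fit (DBF) achieves competitive ratio $\frac43$, i.e., there is a constant $K$ such that $\mathrm{DBF}(L)\le\frac43\,OPT(L)+K$ for all such $L$.
   Context: Online Bin Packing with Estimated Item Sizes: before any item is revealed, the algorithm receives $\delta\in(0,1]$ and an estimated size $c'(a)\in(0,1]$ for each item $a$ of the list $L$ (so it knows the number $n$ of items). Items are then revealed one by one with actual sizes $c(a)\in[c'(a)(1-\delta),\min(c'(a)(1+\delta),1)]$ and must be irrevocably assigned to a bin of capacity $1$ before the next item is revealed; the goal is to minimize the number of bins. $A(L)$ is the number of bins used by $A$ and $OPT(L)$ the optimal number. $A$ is $c$-competitive on a class of inputs if $A(L)\le c\cdot OPT(L)+K$ for a constant $K$ and all $L$ in the class. Best-Fit: place the item into the fullest currently used bin in which it fits; if it fits in no used bin, open a new bin. Delayed-Best-Fit (DBF): let $n$ be the number of announced items. Call an item special if its actual size is at most $\frac12$ and it is among the first $\frac n3$ items of actual size at most $\frac12$ (in order of arrival). When a special item $a$ arrives: if $a$ fits into a bin containing an item of size larger than $\frac12$, pack $a$ into such a bin; otherwise place $a$ into a new empty bin. Every non-special item is packed according to Best-Fit.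
   Formalization: The accuracy δ, the estimated sizes $c'(a)$ and the actual item sizes $c(a)$ are rational numbers. -}

module Defs where

open import Data.Nat as ℕ using (ℕ; suc)
open import Data.Fin using (Fin; _≟_)
open import Data.List using (List; []; _∷_; [_]; _++_; length; lookup; updateAt; foldr; map; allFin)
open import Data.List.Relation.Unary.Any using (Any)
open import Data.Rational using (ℚ; 0ℚ; 1ℚ; ½; _+_; _-_; _*_; _⊓_; _≤_; _<_)
open import Data.Product using (Σ; _×_)
open import Relation.Binary.PropositionalEquality using (_≡_)
open import Relation.Nullary using (¬_; does)
open import Data.Bool using (if_then_else_)

sumℚ : List ℚ → ℚ
sumℚ = foldr _+_ 0ℚ

-- a bin is the list of (actual) sizes of the items packed into it
Bin : Set
Bin = List ℚ

load : Bin → ℚ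
load = sumℚ

Fits : ℚ → Bin → Set
Fits x b = load b + x ≤ 1ℚ

HasBig : Bin → Set
HasBig b = Any (λ y → ½ < y) b

Config : Set
Config = List Bin

putInto : (bs : Config) → Fin (length bs) → ℚ → Config
putInto bs j x = updateAt bs j (x ∷_)

openNew : Config → ℚ → Config
openNew bs x = bs ++ [ x ∷ [] ]

-- One step of Best-Fit (ties between equally full bins broken arbitrarily)

data BFStep (x : ℚ) (bs : Config) : Config → Set where
  bf-into : (j : Fin (length bs)) → Fits x (lookup bs j) →
            (∀ k → Fits x (lookup bs k) → load (lookup bs k) ≤ load (lookup bs j)) →
            BFStep x bs (putInto bs j x)
  bf-new  : (∀ k → ¬ Fits x (lookup bs k)) → BFStep x bs (openNew bs x)

-- One step of DBF for a special item (choice among admissible bins arbitrary)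
data SpecialStep (x : ℚ) (bs : Config) : Config → Set where
  sp-into : (j : Fin (length bs)) → HasBig (lookup bs j) → Fits x (lookup bs j) →
            SpecialStep x bs (putInto bs j x)
  sp-new  : (∀ k → HasBig (lookup bs k) → ¬ Fits x (lookup bs k)) →
            SpecialStep x bs (openNew bs x)

-- DBFRun n r xs bs bs' : with n announced items in total, r items of size
-- ≤ 1/2 already seen, processing the remaining items xs (in arrival order,
-- actual sizes) starting from configuration bs ends in configuration bs'.
-- An item of size ≤ 1/2 is special iff its rank (1-based) among items of
-- size ≤ 1/2 is at most n/3, i.e. 3 * rank ≤ n.

data DBFRun (n : ℕ) : ℕ → List ℚ → Config → Config → Set where
  done    : ∀ {r bs} → DBFRun n r [] bs bs
  special : ∀ {r x xs bs bs' bs''} → x ≤ ½ → 3 ℕ.* suc r ℕ.≤ n →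
            SpecialStep x bs bs' → DBFRun n (suc r) xs bs' bs'' →
            DBFRun n r (x ∷ xs) bs bs''
  small   : ∀ {r x xs bs bs' bs''} → x ≤ ½ → ¬ (3 ℕ.* suc r ℕ.≤ n) →
            BFStep x bs bs' → DBFRun n (suc r) xs bs' bs'' →
            DBFRun n r (x ∷ xs) bs bs''
  large   : ∀ {r x xs bs bs' bs''} → ¬ (x ≤ ½) →
            BFStep x bs bs' → DBFRun n r xs bs' bs'' →
            DBFRun n r (x ∷ xs) bs bs''

DBF-Run : List ℚ → Config → Set
DBF-Run cs bs = DBFRun (length cs) 0 cs [] bs

assignedLoad : (cs : List ℚ) → {m : ℕ} → (Fin (length cs) → Fin m) → Fin m → ℚ
assignedLoad cs f b =
  sumℚ (map (λ i → if does (f i ≟ b) then lookup cs i else 0ℚ) (allFin (length cs)))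

Packable : List ℚ → ℕ → Set
Packable cs m = Σ (Fin (length cs) → Fin m) λ f → ∀ b → assignedLoad cs f b ≤ 1ℚ

IsOPT : List ℚ → ℕ → Set
IsOPT cs k = Packable cs k × (∀ m → Packable cs m → k ℕ.≤ m)

Admissible : ℚ → ℚ → ℚ → Set
Admissible δ e c = (e * (1ℚ - δ) ≤ c) × (c ≤ (e * (1ℚ + δ)) ⊓ 1ℚ)

NoThreeFit : List ℚ → Set
NoThreeFit cs = ∀ (i j k : Fin (length cs)) → ¬ i ≡ j → ¬ i ≡ k → ¬ j ≡ k →
  1ℚ < lookup cs i + lookup cs j + lookup cs k

-- Since no three items fit into a bin, every bin of an optimal packing holds at most two
-- items, so a weight g on sizes with g a ≤ H, and g a + g b ≤ H whenever a + b ≤ 1, has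
-- total at most H · OPT; in particular n ≤ 2 · OPT, and there are at most OPT items
-- larger than ½.
--
-- If no DBF bin consists of a lone special item, every bin contains an ordinary (non-special)
-- item. Then either every item of size at most ½ is special, the ordinary items are the big
-- ones and DBF ≤ OPT, or about n/3 items are special and DBF ≲ 2n/3 ≤ 4/3 · OPT.
--
-- Otherwise let x₀ be the smallest lone special item, and weigh an item of size at most ½
-- by 1 if it is at least x₀ (else 0), a bigger one by 1 if x₀ fits beside it (else 2).
-- These weights satisfy the pair condition with H = 2, and every DBF bin has weight plus
-- number of special items at least 2: a bin of small items was opened by a special item at
-- least x₀ (Best-Fit preferred it to the lone bin), and a bin with a big item beside which
-- x₀ fits contains a special item (special items go beside big items whenever they can).
-- Hence 2 · DBF ≤ 2 · OPT + n/3 ≤ 8/3 · OPT.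

module Submission where

open import Defs
import Algebra.Properties.CommutativeMonoid.Sum as ∑Properties
import Algebra.Properties.CommutativeSemigroup as CommutativeSemigroupProperties
open import Data.Bool using (Bool; true; false; if_then_else_)
open import Data.Empty using (⊥-elim)
open import Data.Fin using (Fin; zero; suc; _≟_)
import Data.List as L
open import Data.List using (List; []; _∷_; _++_; [_]; length; lookup; map; allFin; filter; tabulate)
open import Data.List.Properties using (map-tabulate; tabulate-lookup; map-++; map-cong; map-∘; length-map)
open import Data.List.Relation.Unary.All as All using (All; []; _∷_)
open import Data.List.Relation.Unary.All.Properties using (map⁺; ++⁺; ++⁻; ∷ʳ⁺; All¬⇒¬Any)
open import Data.List.Relation.Unary.Any as Any using (Any; here; there)
import Data.List.Relation.Unary.Any.Properties as AnyP
open import Data.List.Membership.Propositional using (_∈_; find; lose)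
open import Data.List.Membership.Propositional.Properties
  using (∈-lookup; ∈-++⁻; ∈-++⁺ˡ; ∈-++⁺ʳ; ∈-insert)
open import Data.List.Relation.Unary.AllPairs using ([]; _∷_)
open import Data.List.Relation.Binary.Pointwise using (Pointwise; []; _∷_)
open import Data.List.Relation.Unary.Unique.Propositional using (Unique)
open import Data.List.Relation.Unary.Unique.Propositional.Properties using (allFin⁺; filter⁺)
open import Data.Nat using (ℕ; zero; suc; z≤n; s≤s)
  renaming (_+_ to _+ℕ_; _≤_ to _≤ℕ_; _<_ to _<ℕ_; _*_ to _*ℕ_)
open import Data.Nat.ListAction using (sum)
import Data.Nat.Properties as ℕP
open import Data.Nat.Tactic.RingSolver using (solve)
open import Data.Rational
  using (ℚ; 0ℚ; 1ℚ; ½; _+_; _-_; -_; _*_; _≤_; _<_; _≤?_; _<?_; NonNegative; nonNegative)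
import Data.Rational.Properties as ℚP
open import Data.Product using (Σ; _×_; _,_; proj₁; proj₂)
open import Data.Sum using (_⊎_; inj₁; inj₂; [_,_]′)
open import Function using (_∘_; case_of_)
open import Relation.Binary.Bundles using (DecTotalOrder)
open import Data.List.Extrema (DecTotalOrder.totalOrder ℚP.≤-decTotalOrder)
  using (min; min≤xs; argmin-sel)
open import Relation.Binary.PropositionalEquality
  using (_≡_; _≢_; refl; sym; trans; cong; cong₂; subst; subst₂; module ≡-Reasoning)
open import Relation.Nullary using (¬_; Dec; does; yes; no)
open import Relation.Nullary.Decidable using (dec-true; dec-false)

open ∑Properties ℕP.+-0-commutativeMonoid
  using (∑-distrib-+; sum-replicate-zero; sum-cong-≗; sum-syntax) renaming (sum to ∑)
open CommutativeSemigroupProperties ℕP.+-commutativeSemigroup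
  using (x∙yz≈y∙xz; xy∙z≈y∙xz; interchange)

InUnit : ℚ → Set
InUnit c = 0ℚ ≤ c × c ≤ 1ℚ

<⇒≱ : ∀ {p q} → p < q → ¬ q ≤ p
<⇒≱ p<q q≤p = ℚP.<-irrefl refl (ℚP.<-≤-trans p<q q≤p)

p≤p+q : ∀ {p q} → 0ℚ ≤ q → p ≤ p + q
p≤p+q {p} 0≤q = subst (_≤ p + _) (ℚP.+-identityʳ p) (ℚP.+-monoʳ-≤ p 0≤q)

sumℚ-nonneg : ∀ {xs} → All (0ℚ ≤_) xs → 0ℚ ≤ sumℚ xs
sumℚ-nonneg [] = ℚP.≤-refl
sumℚ-nonneg (0≤x ∷ 0≤xs) = ℚP.+-mono-≤ 0≤x (sumℚ-nonneg 0≤xs)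

if-yes : ∀ {P A : Set} (d : Dec P) {a b : A} → P → (if does d then a else b) ≡ a
if-yes d p = cong (λ t → if t then _ else _) (dec-true d p)

if-no : ∀ {P A : Set} (d : Dec P) {a b : A} → ¬ P → (if does d then a else b) ≡ b
if-no d ¬p = cong (λ t → if t then _ else _) (dec-false d ¬p)

if-elim : ∀ {P A : Set} {Q : A → Set} (d : Dec P) {a b} → Q a → Q b → Q (if does d then a else b)
if-elim (yes _) qa _  = qa
if-elim (no _)  _  qb = qb

-- Weight bounds from an optimal packing

record PairBound (H : ℕ) (g : ℚ → ℕ) : Set where
  field
    single : ∀ x → g x ≤ℕ H
    pair   : ∀ x y → x + y ≤ 1ℚ → g x +ℕ g y ≤ℕ H

∑-indicator : ∀ {m} (s : Fin m) v → ∑ (λ t → if does (s ≟ t) then v else 0) ≡ v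
∑-indicator {suc m} zero v = trans (cong (v +ℕ_) (sum-replicate-zero m)) (ℕP.+-identityʳ v)
∑-indicator {suc m} (suc s) v = ∑-indicator s v

∑-≤ : ∀ {m} (F : Fin m → ℕ) {H} → (∀ t → F t ≤ℕ H) → ∑ F ≤ℕ m *ℕ H
∑-≤ {zero} F F≤H = z≤n
∑-≤ {suc m} F F≤H = ℕP.+-mono-≤ (F≤H zero) (∑-≤ (F ∘ suc) (F≤H ∘ suc))

module _ (cs : List ℚ) {m : ℕ} (f : Fin (length cs) → Fin m) where

  private
    c : Fin (length cs) → ℚ
    c = lookup cs

  inBin : Fin m → List (Fin (length cs)) → List (Fin (length cs))
  inBin t = filter (λ i → f i ≟ t)

  sum-by-bins : (h : Fin (length cs) → ℕ) → ∀ is →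
    sum (map h is) ≡ ∑[ t < m ] sum (map h (inBin t is))
  sum-by-bins h [] = sym (sum-replicate-zero m)
  sum-by-bins h (i ∷ is) = begin
    h i +ℕ sum (map h is)
      ≡⟨ cong₂ _+ℕ_ (sym (∑-indicator (f i) (h i))) (sum-by-bins h is) ⟩
    ∑[ t < m ] (if does (f i ≟ t) then h i else 0) +ℕ ∑[ t < m ] sum (map h (inBin t is))
      ≡⟨ sym (∑-distrib-+ {m} _ _) ⟩
    ∑[ t < m ] ((if does (f i ≟ t) then h i else 0) +ℕ sum (map h (inBin t is)))
      ≡⟨ sum-cong-≗ split ⟩
    ∑[ t < m ] sum (map h (inBin t (i ∷ is))) ∎
    where
    open ≡-Reasoning
    split : ∀ t → (if does (f i ≟ t) then h i else 0) +ℕ sum (map h (inBin t is))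
                ≡ sum (map h (inBin t (i ∷ is)))
    split t with does (f i ≟ t)
    ... | true  = refl
    ... | false = refl

  assignedLoad-inBin : ∀ t → assignedLoad cs f t ≡ sumℚ (map c (inBin t (allFin (length cs))))
  assignedLoad-inBin t = go (allFin (length cs))
    where
    go : ∀ is → sumℚ (map (λ i → if does (f i ≟ t) then c i else 0ℚ) is)
              ≡ sumℚ (map c (inBin t is))
    go [] = refl
    go (i ∷ is) with does (f i ≟ t)
    ... | true  = cong (c i +_) (go is)
    ... | false = trans (ℚP.+-identityˡ _) (go is)

  module _ (nonneg : All (0ℚ ≤_) cs) (noThree : NoThreeFit cs) {H} {g} (bound : PairBound H g) where
    open PairBound bound

    -- A bin of a packing holds at most two items, as any three would fit together.
    bin-weight≤ : ∀ is → Unique is → sumℚ (map c is) ≤ 1ℚ → sum (map (g ∘ c) is) ≤ℕ H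
    bin-weight≤ [] _ _ = z≤n
    bin-weight≤ (i ∷ []) _ _ = subst (_≤ℕ H) (sym (ℕP.+-identityʳ _)) (single (c i))
    bin-weight≤ (i ∷ j ∷ []) _ load≤1 =
      subst (_≤ℕ H) (cong (g (c i) +ℕ_) (sym (ℕP.+-identityʳ _)))
        (pair (c i) (c j) (subst (λ z → c i + z ≤ 1ℚ) (ℚP.+-identityʳ (c j)) load≤1))
    bin-weight≤ (i ∷ j ∷ k ∷ is) ((i≢j ∷ i≢k ∷ _) ∷ (j≢k ∷ _) ∷ _) load≤1 =
      ⊥-elim (<⇒≱ (noThree i j k i≢j i≢k j≢k) three≤1)
      where
      rest≥0 : 0ℚ ≤ sumℚ (map c is)
      rest≥0 = sumℚ-nonneg (map⁺ (All.universal (λ i → All.lookup nonneg (∈-lookup i)) is))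
      three≤1 : c i + c j + c k ≤ 1ℚ
      three≤1 = ℚP.≤-trans (ℚP.≤-reflexive (ℚP.+-assoc (c i) (c j) (c k)))
        (ℚP.≤-trans (ℚP.+-monoʳ-≤ (c i) (ℚP.+-monoʳ-≤ (c j) (p≤p+q rest≥0))) load≤1)

    sum-weights≤ : (∀ t → assignedLoad cs f t ≤ 1ℚ) → sum (map g cs) ≤ℕ m *ℕ H
    sum-weights≤ fits = begin
      sum (map g cs)
        ≡⟨ cong sum weights-by-index ⟩
      sum (map (g ∘ c) (allFin (length cs)))
        ≡⟨ sum-by-bins (g ∘ c) (allFin (length cs)) ⟩
      ∑[ t < m ] sum (map (g ∘ c) (inBin t (allFin (length cs))))
        ≤⟨ ∑-≤ _ (λ t → bin-weight≤ _ (filter⁺ _ (allFin⁺ (length cs)))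
                          (subst (_≤ 1ℚ) (assignedLoad-inBin t) (fits t))) ⟩
      m *ℕ H ∎
      where
      open ℕP.≤-Reasoning
      weights-by-index : map g cs ≡ map (g ∘ c) (allFin (length cs))
      weights-by-index = trans (cong (map g) (sym (tabulate-lookup cs)))
        (trans (map-tabulate c g) (sym (map-tabulate (λ i → i) (g ∘ c))))

weights≤packing : ∀ {cs m H g} → All (0ℚ ≤_) cs → NoThreeFit cs → PairBound H g →
                  Packable cs m → sum (map g cs) ≤ℕ m *ℕ H
weights≤packing {cs} nonneg noThree bound (f , fits) = sum-weights≤ cs f nonneg noThree bound fits

-- Tagged configurations

record Item : Set where
  constructor item
  field
    size      : ℚ
    isSpecial : Bool

open Item

TBin : Set
TBin = List Item

TConfig : Set
TConfig = List TBin

sizes : TBin → Bin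
sizes = map size

untag : TConfig → Config
untag = map sizes

Special Ordinary Small Big OrdinarySmall : Item → Set
Special i       = isSpecial i ≡ true
Ordinary i      = isSpecial i ≡ false
Small i         = size i ≤ ½
Big i           = ½ < size i
OrdinarySmall i = Ordinary i × Small i

lone : ℚ → TBin
lone x = item x true ∷ []

-- The (r + 1)-st item of size at most ½ is special.
SpecialPhase : ℕ → ℕ → Set
SpecialPhase n r = 3 *ℕ suc r ≤ℕ n

-- Items are consed onto a bin, so the item that opened it is the last one.
data OpenedBy (P : Item → Set) : TBin → Set where
  opener : ∀ {i} → P i → OpenedBy P (i ∷ [])
  _∷_    : ∀ {B} i → OpenedBy P B → OpenedBy P (i ∷ B)

zipOpened : ∀ {P Q B} → OpenedBy P B → OpenedBy Q B → OpenedBy (λ o → P o × Q o) B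
zipOpened (opener p) (opener q) = opener (p , q)
zipOpened (i ∷ p)    (.i ∷ q)   = i ∷ zipOpened p q
zipOpened (opener _) (_ ∷ ())
zipOpened (_ ∷ ())   (opener _)

opened⇒any : ∀ {P B} → OpenedBy P B → Any P B
opened⇒any (opener p) = here p
opened⇒any (i ∷ p)    = there (opened⇒any p)

opened-singleton : ∀ {P i} → OpenedBy P (i ∷ []) → P i
opened-singleton (opener p) = p
opened-singleton (_ ∷ ())

specialI ordinaryI : Item → ℕ
specialI i  = if isSpecial i then 1 else 0
ordinaryI i = if isSpecial i then 0 else 1

smallI bigI : ℚ → ℕ
smallI c = if does (c ≤? ½) then 1 else 0
bigI   c = if does (c ≤? ½) then 0 else 1

binWeight : (Item → ℕ) → TBin → ℕ
binWeight w B = sum (map w B)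

count : (Item → ℕ) → TConfig → ℕ
count w G = sum (map (binWeight w) G)

count-into : ∀ w Gpre i B Gpost →
  count w (Gpre ++ (i ∷ B) ∷ Gpost) ≡ w i +ℕ count w (Gpre ++ B ∷ Gpost)
count-into w []        i B Gpost = ℕP.+-assoc (w i) (binWeight w B) (count w Gpost)
count-into w (C ∷ Gpre) i B Gpost =
  trans (cong (binWeight w C +ℕ_) (count-into w Gpre i B Gpost)) (x∙yz≈y∙xz (binWeight w C) (w i) _)

count-snoc : ∀ w G i → count w (G ++ [ i ∷ [] ]) ≡ w i +ℕ count w G
count-snoc w []      i = cong (_+ℕ 0) (ℕP.+-identityʳ (w i))
count-snoc w (C ∷ G) i =
  trans (cong (binWeight w C +ℕ_) (count-snoc w G i)) (x∙yz≈y∙xz (binWeight w C) (w i) _)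

-- s counts the special items among the first r items of size at most ½.
record PhaseCount (n r s : ℕ) : Set where
  field
    s≤r       : s ≤ℕ r
    3s≤n      : 3 *ℕ s ≤ℕ n
    saturated : s ≡ r ⊎ n <ℕ 3 *ℕ suc s

specialPhase⇒all-special : ∀ {n r s} → SpecialPhase n r → PhaseCount n r s → s ≡ r
specialPhase⇒all-special sp count with PhaseCount.saturated count
... | inj₁ s≡r = s≡r
... | inj₂ n<3[1+s] = ⊥-elim (ℕP.<⇒≱ n<3[1+s]
        (ℕP.≤-trans (ℕP.*-monoʳ-≤ 3 (s≤s (PhaseCount.s≤r count))) sp))

phaseCount-special : ∀ {n r s} → SpecialPhase n r → PhaseCount n r s → PhaseCount n (suc r) (suc s)
phaseCount-special sp count with specialPhase⇒all-special sp count
... | refl = record { s≤r = ℕP.≤-refl ; 3s≤n = sp ; saturated = inj₁ refl }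

phaseCount-late : ∀ {n r s} → ¬ SpecialPhase n r → PhaseCount n r s → PhaseCount n (suc r) s
phaseCount-late {n} {r} {s} over count = record
  { s≤r       = ℕP.m≤n⇒m≤1+n s≤r
  ; 3s≤n      = 3s≤n
  ; saturated = inj₂ n<3[1+s]
  }
  where
  open PhaseCount count
  n<3[1+s] : n <ℕ 3 *ℕ suc s
  n<3[1+s] with saturated
  ... | inj₁ refl = ℕP.≰⇒> over
  ... | inj₂ n<3[1+s] = n<3[1+s]

phaseOver-mono : ∀ {n r r'} → r ≤ℕ r' → ¬ SpecialPhase n r → ¬ SpecialPhase n r'
phaseOver-mono r≤r' over sp = over (ℕP.≤-trans (ℕP.*-monoʳ-≤ 3 (s≤s r≤r')) sp)

data OrdinaryArrival (n r : ℕ) (x : ℚ) : ℕ → Set where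
  small : x ≤ ½ → ¬ SpecialPhase n r → OrdinaryArrival n r x (suc r)
  large : ¬ x ≤ ½ → OrdinaryArrival n r x r

module _ {n r r' : ℕ} {x : ℚ} where

  arrival-smallI : OrdinaryArrival n r x r' → smallI x +ℕ r ≡ r'
  arrival-smallI (small x≤½ _) = cong (_+ℕ r) (if-yes (x ≤? ½) x≤½)
  arrival-smallI (large x≰½)   = cong (_+ℕ r) (if-no (x ≤? ½) x≰½)

  arrival-≤ : OrdinaryArrival n r x r' → r ≤ℕ r'
  arrival-≤ (small _ _) = ℕP.n≤1+n r
  arrival-≤ (large _)   = ℕP.≤-refl

  arrival-count : ∀ {s} → OrdinaryArrival n r x r' → PhaseCount n r s → PhaseCount n r' s
  arrival-count (small _ over) = phaseCount-late over
  arrival-count (large _)      = λ count → count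

  arrival-late : OrdinaryArrival n r x r' → x ≤ ½ → ¬ SpecialPhase n r'
  arrival-late (small _ over) _ = phaseOver-mono (ℕP.n≤1+n r) over
  arrival-late (large x≰½) x≤½  = ⊥-elim (x≰½ x≤½)

half+half≤1 : ∀ {p q} → p ≤ ½ → q ≤ ½ → p + q ≤ 1ℚ
half+half≤1 = ℚP.+-mono-≤

big+big≰1 : ∀ {p q} → ¬ p ≤ ½ → ¬ q ≤ ½ → ¬ p + q ≤ 1ℚ
big+big≰1 p≰½ q≰½ = <⇒≱ (ℚP.+-mono-< (ℚP.≰⇒> p≰½) (ℚP.≰⇒> q≰½))

fits-lone : ∀ {x y} → y + x ≤ 1ℚ → Fits x (sizes (lone y))
fits-lone {x} {y} = subst (λ z → z + x ≤ 1ℚ) (sym (ℚP.+-identityʳ y))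

load-nonneg : ∀ {B} → All (λ i → 0ℚ ≤ size i) B → 0ℚ ≤ load (sizes B)
load-nonneg = sumℚ-nonneg ∘ map⁺

size≤load : ∀ {B i} → All (λ i → 0ℚ ≤ size i) B → i ∈ B → size i ≤ load (sizes B)
size≤load (_ ∷ nonneg)   (here refl) = p≤p+q (load-nonneg nonneg)
size≤load {j ∷ _} (0≤j ∷ nonneg) (there i∈B) =
  ℚP.≤-trans (size≤load nonneg i∈B) (subst (_ ≤_) (ℚP.+-comm _ (size j)) (p≤p+q 0≤j))

¬special⇒ordinary : ∀ {i} → ¬ Special i → Ordinary i
¬special⇒ordinary {item _ true}  ¬special = ⊥-elim (¬special refl)
¬special⇒ordinary {item _ false} _        = refl

big⇒ordinary : ∀ {i} → (Special i → Small i) → Big i → Ordinary i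
big⇒ordinary {i} special⇒small big = ¬special⇒ordinary {i} (<⇒≱ big ∘ special⇒small)

ordinary-notSmall⇒big : ∀ {i} → Ordinary i → ¬ OrdinarySmall i → Big i
ordinary-notSmall⇒big ordinary notOS = ℚP.≰⇒> (λ small → notOS (ordinary , small))

Any-∩ : ∀ {A : Set} {P Q : A → Set} {xs} → All P xs → Any Q xs → Any (λ x → P x × Q x) xs
Any-∩ (p ∷ _)  (here q)  = here (p , q)
Any-∩ (_ ∷ ps) (there q) = there (Any-∩ ps q)

special? : ∀ i → Dec (Special i)
special? i = isSpecial i Data.Bool.≟ true

-- The invariant of a DBF run

record WellFormed (n r : ℕ) (B : TBin) : Set where
  field
    nonEmpty        : B ≢ []
    nonneg          : All (λ i → 0ℚ ≤ size i) B
    special⇒small   : All (λ i → Special i → Small i) B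
    load≤1          : load (sizes B) ≤ 1ℚ
    shared⇒ordinary : 1 <ℕ length B → Any Ordinary B
    late            : All (λ i → OrdinarySmall i → ¬ SpecialPhase n r) B

wellFormed-mono : ∀ {n r r' B} → r ≤ℕ r' → WellFormed n r B → WellFormed n r' B
wellFormed-mono r≤r' wf = record
  { nonEmpty = nonEmpty ; nonneg = nonneg ; special⇒small = special⇒small ; load≤1 = load≤1
  ; shared⇒ordinary = shared⇒ordinary
  ; late = All.map (λ over os → phaseOver-mono r≤r' (over os)) late
  }
  where open WellFormed wf

wellFormed-∷ : ∀ {n r i B} → WellFormed n r B → 0ℚ ≤ size i → Fits (size i) (sizes B) →
  (Special i → Small i) → Any Ordinary (i ∷ B) → (OrdinarySmall i → ¬ SpecialPhase n r) →
  WellFormed n r (i ∷ B)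
wellFormed-∷ {i = i} {B} wf 0≤i fits i-special⇒small someOrdinary i-late = record
  { nonEmpty        = λ ()
  ; nonneg          = 0≤i ∷ nonneg
  ; special⇒small   = i-special⇒small ∷ special⇒small
  ; load≤1          = subst (_≤ 1ℚ) (ℚP.+-comm (load (sizes B)) (size i)) fits
  ; shared⇒ordinary = λ _ → someOrdinary
  ; late            = i-late ∷ late
  }
  where open WellFormed wf

wellFormed-singleton : ∀ {n r i} → InUnit (size i) → (Special i → Small i) →
  (OrdinarySmall i → ¬ SpecialPhase n r) → WellFormed n r (i ∷ [])
wellFormed-singleton {i = i} (0≤i , i≤1) i-special⇒small i-late = record
  { nonEmpty        = λ ()
  ; nonneg          = 0≤i ∷ []
  ; special⇒small   = i-special⇒small ∷ []
  ; load≤1          = subst (_≤ 1ℚ) (sym (ℚP.+-identityʳ (size i))) i≤1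
  ; shared⇒ordinary = λ { (s≤s ()) }
  ; late            = i-late ∷ []
  }

-- What every bin satisfies once some bin holds just a special item of size x.
record Compatible (x : ℚ) (B : TBin) : Set where
  field
    opener-notOrdinarySmall : OpenedBy (λ o → ¬ OrdinarySmall o) B
    opener-≥                : All Small B → 1 <ℕ length B → OpenedBy (λ o → x ≤ size o) B
    bigFitting⇒special      : Any (λ Y → Big Y × x + size Y ≤ 1ℚ) B → Any Special B

record Invariant (n r : ℕ) (G : TConfig) : Set where
  field
    wellFormed : All (WellFormed n r) G
    compatible : ∀ {x} → lone x ∈ G → All (Compatible x) G
    smalls     : count (smallI ∘ size) G ≡ r
    specials   : PhaseCount n r (count specialI G)

invariant-empty : ∀ n → Invariant n 0 []
invariant-empty n = record
  { wellFormed = []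
  ; compatible = λ ()
  ; smalls     = refl
  ; specials   = record { s≤r = z≤n ; 3s≤n = z≤n ; saturated = inj₁ refl }
  }

All-replace : ∀ {P : TBin → Set} Gpre {B B'} Gpost →
  All P (Gpre ++ B ∷ Gpost) → P B' → All P (Gpre ++ B' ∷ Gpost)
All-replace Gpre Gpost all pB' with ++⁻ Gpre all
... | pre , _ ∷ post = ++⁺ pre (pB' ∷ post)

lone∈-replace : ∀ {x} Gpre {i B} Gpost → B ≢ [] →
  lone x ∈ Gpre ++ (i ∷ B) ∷ Gpost → lone x ∈ Gpre ++ B ∷ Gpost
lone∈-replace Gpre Gpost B≢[] ls with ∈-++⁻ Gpre ls
... | inj₁ ls∈pre         = ∈-++⁺ˡ ls∈pre
... | inj₂ (here refl)    = ⊥-elim (B≢[] refl)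
... | inj₂ (there ls∈post) = ∈-++⁺ʳ Gpre (there ls∈post)

lone∈-snoc : ∀ {x G B} → lone x ∈ G ++ [ B ] → lone x ∈ G ⊎ lone x ≡ B
lone∈-snoc {G = G} ls with ∈-++⁻ G ls
... | inj₁ ls∈G      = inj₁ ls∈G
... | inj₂ (here eq) = inj₂ eq

r≤smallI+r : ∀ {r r'} i → smallI (size i) +ℕ r ≡ r' → r ≤ℕ r'
r≤smallI+r {r} i refl = ℕP.m≤n+m r (smallI (size i))

big-blocks-big : ∀ {B x} → All (λ i → 0ℚ ≤ size i) B → Any Big B → ½ < x → ¬ Fits x (sizes B)
big-blocks-big nonneg big x>½ fits with find big
... | Y , Y∈B , Y>½ = <⇒≱ (ℚP.+-mono-< Y>½ x>½)
  (ℚP.≤-trans (ℚP.+-monoˡ-≤ _ (size≤load nonneg Y∈B)) fits)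

noSpecial⇒big : ∀ {B} → All (λ i → ¬ Special i) B → OpenedBy (λ o → ¬ OrdinarySmall o) B →
                Any Big B
noSpecial⇒big noSpecial opened =
  Any.map (λ {i} (¬s , ¬os) → ordinary-notSmall⇒big {i} (¬special⇒ordinary {i} ¬s) ¬os)
          (Any-∩ noSpecial (opened⇒any opened))

openedAbove-∷ : ∀ {x' i B} → B ≢ [] → load (sizes (lone x')) ≤ load (sizes B) →
  (All Small B → 1 <ℕ length B → OpenedBy (λ o → x' ≤ size o) B) → All Small B →
  OpenedBy (λ o → x' ≤ size o) (i ∷ B)
openedAbove-∷ {B = []} B≢[] _ _ _ = ⊥-elim (B≢[] refl)
openedAbove-∷ {x'} {B = b ∷ []} _ lone≤b _ _ =
  _ ∷ opener (subst₂ _≤_ (ℚP.+-identityʳ x') (ℚP.+-identityʳ (size b)) lone≤b)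
openedAbove-∷ {B = b ∷ c ∷ cs} _ _ openedAbove allSmall = _ ∷ openedAbove allSmall (s≤s (s≤s z≤n))

module Into {n r : ℕ} (Gpre : TConfig) (B : TBin) (Gpost : TConfig)
            (inv : Invariant n r (Gpre ++ B ∷ Gpost)) where

  open Invariant inv

  private
    G : TConfig
    G = Gpre ++ B ∷ Gpost

    wfB : WellFormed n r B
    wfB = All.lookup wellFormed (∈-insert Gpre)

    compatibleB : ∀ {x} → lone x ∈ G → Compatible x B
    compatibleB ls = All.lookup (compatible ls) (∈-insert Gpre)

  open WellFormed wfB

  invariant-into : ∀ {r'} i → smallI (size i) +ℕ r ≡ r' → WellFormed n r' (i ∷ B) →
    (∀ {x} → lone x ∈ G → Compatible x (i ∷ B)) →
    PhaseCount n r' (specialI i +ℕ count specialI G) →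
    Invariant n r' (Gpre ++ (i ∷ B) ∷ Gpost)
  invariant-into {r'} i smallI+r≡r' wf compat phaseCount = record
    { wellFormed = All-replace Gpre Gpost
                     (All.map (wellFormed-mono (r≤smallI+r i smallI+r≡r')) wellFormed) wf
    ; compatible = λ ls → let ls′ = lone∈-replace Gpre Gpost nonEmpty ls in
                          All-replace Gpre Gpost (compatible ls′) (compat ls′)
    ; smalls     = trans (count-into (smallI ∘ size) Gpre i B Gpost)
                         (trans (cong (smallI (size i) +ℕ_) smalls) smallI+r≡r')
    ; specials   = subst (PhaseCount n r') (sym (count-into specialI Gpre i B Gpost)) phaseCount
    }

  special-into : ∀ {x} → x ≤ ½ → 0ℚ ≤ x → SpecialPhase n r → Any Big B → Fits x (sizes B) →
    Invariant n (suc r) (Gpre ++ (item x true ∷ B) ∷ Gpost)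
  special-into {x} x≤½ 0≤x sp big fits =
    invariant-into (item x true) (cong (_+ℕ r) (if-yes (x ≤? ½) x≤½))
      wf compat (phaseCount-special sp specials)
    where
    wf : WellFormed n (suc r) (item x true ∷ B)
    wf = wellFormed-∷ (wellFormed-mono (ℕP.n≤1+n r) wfB) 0≤x fits (λ _ → x≤½)
      (there (Any.map (λ (s⇒s , b) → big⇒ordinary s⇒s b) (Any-∩ special⇒small big))) (λ ())
    compat : ∀ {x'} → lone x' ∈ G → Compatible x' (item x true ∷ B)
    compat ls = record
      { opener-notOrdinarySmall = _ ∷ opener-notOrdinarySmall
      ; opener-≥                = λ { (_ ∷ allSmall) _ →
                                    ⊥-elim (All¬⇒¬Any (All.map (λ s b → <⇒≱ b s) allSmall) big) }
      ; bigFitting⇒special      = λ _ → here refl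
      }
      where open Compatible (compatibleB ls)

  ordinary-into : ∀ {x r'} → OrdinaryArrival n r x r' → 0ℚ ≤ x → Fits x (sizes B) →
    All (λ C → Fits x (sizes C) → load (sizes C) ≤ load (sizes B)) G →
    Invariant n r' (Gpre ++ (item x false ∷ B) ∷ Gpost)
  ordinary-into {x} {r'} arrival 0≤x fits fullest =
    invariant-into (item x false) (arrival-smallI arrival)
      wf compat (arrival-count arrival specials)
    where
    wf : WellFormed n r' (item x false ∷ B)
    wf = wellFormed-∷ (wellFormed-mono (arrival-≤ arrival) wfB) 0≤x fits (λ ()) (here refl)
      (λ (_ , x≤½) → arrival-late arrival x≤½)
    compat : ∀ {x'} → lone x' ∈ G → Compatible x' (item x false ∷ B)
    compat {x'} ls = record
      { opener-notOrdinarySmall = _ ∷ opener-notOrdinarySmall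
      ; opener-≥                = opener-≥′
      ; bigFitting⇒special      = bigFitting⇒special′
      }
      where
      open Compatible (compatibleB ls)
      x'≤½ : x' ≤ ½
      x'≤½ = All.head (WellFormed.special⇒small (All.lookup wellFormed ls)) refl
      -- Best-Fit preferred B to the lone bin, which x would also have fitted.
      opener-≥′ : All Small (item x false ∷ B) → 1 <ℕ suc (length B) →
                  OpenedBy (λ o → x' ≤ size o) (item x false ∷ B)
      opener-≥′ (x≤½ ∷ allSmall) _ = openedAbove-∷ nonEmpty
        (All.lookup fullest ls (fits-lone {x} {x'} (half+half≤1 x'≤½ x≤½))) opener-≥ allSmall
      bigFitting⇒special′ : Any (λ Y → Big Y × x' + size Y ≤ 1ℚ) (item x false ∷ B) →
                            Any Special (item x false ∷ B)
      bigFitting⇒special′ (there bigFitting) = there (bigFitting⇒special bigFitting)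
      bigFitting⇒special′ (here (x>½ , x'+x≤1)) with All.search special? B
      ... | inj₂ someSpecial = there someSpecial
      ... | inj₁ noSpecial =
        ⊥-elim (big-blocks-big nonneg (noSpecial⇒big noSpecial opener-notOrdinarySmall) x>½ fits)

all⇒opened : ∀ {P B} → B ≢ [] → All P B → OpenedBy P B
all⇒opened B≢[] []               = ⊥-elim (B≢[] refl)
all⇒opened _    (p ∷ [])         = opener p
all⇒opened _    (_ ∷ ps@(_ ∷ _)) = _ ∷ all⇒opened (λ ()) ps

lone-compatible : ∀ {x x'} → x ≤ ½ → Compatible x' (lone x)
lone-compatible x≤½ = record
  { opener-notOrdinarySmall = opener (λ ())
  ; opener-≥                = λ { _ (s≤s ()) }
  ; bigFitting⇒special      = λ { (here (x>½ , _)) → ⊥-elim (<⇒≱ x>½ x≤½) }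
  }

bigBin-fits : ∀ {x C} → All (λ i → 0ℚ ≤ size i) C → load (sizes C) ≤ 1ℚ → All Big C →
  Any (λ Y → x + size Y ≤ 1ℚ) C → Fits x (sizes C)
bigBin-fits {x} {Y ∷ []} _ _ _ (here x+Y≤1) =
  fits-lone {x} {size Y} (subst (_≤ 1ℚ) (ℚP.+-comm x (size Y)) x+Y≤1)
bigBin-fits {C = c ∷ d ∷ cs} (_ ∷ nonneg) load≤1 (c>½ ∷ d>½ ∷ _) _ =
  ⊥-elim (big-blocks-big nonneg (here d>½) c>½ (subst (_≤ 1ℚ) (ℚP.+-comm (size c) _) load≤1))

-- During the special phase there are no ordinary small items.
compatible-with-new-lone : ∀ {n r x C} → SpecialPhase n r → WellFormed n r C →
  (Any Big C → ¬ Fits x (sizes C)) → Compatible x C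
compatible-with-new-lone {x = x} {C} sp wf bigBlocks = record
  { opener-notOrdinarySmall = all⇒opened nonEmpty noOrdinarySmall
  ; opener-≥                = λ allSmall shared →
                                noOrdinarySmall-shared allSmall (shared⇒ordinary shared)
  ; bigFitting⇒special      = bigFitting⇒special
  }
  where
  open WellFormed wf
  noOrdinarySmall : All (λ i → ¬ OrdinarySmall i) C
  noOrdinarySmall = All.map (λ over os → over os sp) late
  noOrdinarySmall-shared : ∀ {A : Set} → All Small C → Any Ordinary C → A
  noOrdinarySmall-shared allSmall someOrdinary with find (Any-∩ allSmall someOrdinary)
  ... | _ , i∈C , i≤½ , ord = ⊥-elim (All.lookup noOrdinarySmall i∈C (ord , i≤½))
  bigFitting⇒special : Any (λ Y → Big Y × x + size Y ≤ 1ℚ) C → Any Special C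
  bigFitting⇒special bigFitting with All.search special? C
  ... | inj₂ someSpecial = someSpecial
  ... | inj₁ noSpecial = ⊥-elim (bigBlocks (Any.map proj₁ bigFitting)
          (bigBin-fits nonneg load≤1 allBig (Any.map proj₂ bigFitting)))
    where
    allBig : All Big C
    allBig = All.zipWith
      (λ {i} (¬s , ¬os) → ordinary-notSmall⇒big {i} (¬special⇒ordinary {i} ¬s) ¬os)
      (noSpecial , noOrdinarySmall)

module Open {n r : ℕ} (G : TConfig) (inv : Invariant n r G) where

  open Invariant inv

  invariant-open : ∀ {r'} i → smallI (size i) +ℕ r ≡ r' → WellFormed n r' (i ∷ []) →
    (∀ {x} → lone x ∈ G → Compatible x (i ∷ [])) →
    (∀ {x} → lone x ≡ i ∷ [] → All (Compatible x) (G ++ [ i ∷ [] ])) →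
    PhaseCount n r' (specialI i +ℕ count specialI G) →
    Invariant n r' (G ++ [ i ∷ [] ])
  invariant-open {r'} i smallI+r≡r' wf compat compatNew phaseCount = record
    { wellFormed = ∷ʳ⁺ (All.map (wellFormed-mono (r≤smallI+r i smallI+r≡r')) wellFormed) wf
    ; compatible = λ ls →
        [ (λ ls′ → ∷ʳ⁺ (compatible ls′) (compat ls′)) , compatNew ]′ (lone∈-snoc ls)
    ; smalls     = trans (count-snoc (smallI ∘ size) G i)
                         (trans (cong (smallI (size i) +ℕ_) smalls) smallI+r≡r')
    ; specials   = subst (PhaseCount n r') (sym (count-snoc specialI G i)) phaseCount
    }

  special-open : ∀ {x} → x ≤ ½ → InUnit x → SpecialPhase n r →
    All (λ C → Any Big C → ¬ Fits x (sizes C)) G →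
    Invariant n (suc r) (G ++ [ lone x ])
  special-open {x} x≤½ x∈[0,1] sp bigBlocks =
    invariant-open (item x true) (cong (_+ℕ r) (if-yes (x ≤? ½) x≤½))
      wf (λ _ → lone-compatible x≤½) compatNew (phaseCount-special sp specials)
    where
    wf : WellFormed n (suc r) (lone x)
    wf = wellFormed-singleton x∈[0,1] (λ _ → x≤½) (λ ())
    compatNew : ∀ {x'} → lone x' ≡ lone x → All (Compatible x') (G ++ [ lone x ])
    compatNew refl = ∷ʳ⁺ (All.zipWith (λ (wf , blocks) → compatible-with-new-lone sp wf blocks)
                                       (wellFormed , bigBlocks))
                         (lone-compatible x≤½)

  ordinary-open : ∀ {x r'} → OrdinaryArrival n r x r' → InUnit x →
    All (λ C → ¬ Fits x (sizes C)) G →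
    Invariant n r' (G ++ [ item x false ∷ [] ])
  ordinary-open {x} {r'} arrival x∈[0,1] noFit =
    invariant-open (item x false) (arrival-smallI arrival)
      wf compat (λ ()) (arrival-count arrival specials)
    where
    wf : WellFormed n r' (item x false ∷ [])
    wf = wellFormed-singleton x∈[0,1] (λ ()) (λ (_ , x≤½) → arrival-late arrival x≤½)
    -- x fitted into no bin, in particular not beside x' ≤ ½, so x is big.
    compat : ∀ {x'} → lone x' ∈ G → Compatible x' (item x false ∷ [])
    compat {x'} ls = record
      { opener-notOrdinarySmall = opener (λ (_ , x≤½) → noFitLone (half+half≤1 x'≤½ x≤½))
      ; opener-≥                = λ { _ (s≤s ()) }
      ; bigFitting⇒special      = λ { (here (_ , x'+x≤1)) → ⊥-elim (noFitLone x'+x≤1) }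
      }
      where
      x'≤½ : x' ≤ ½
      x'≤½ = All.head (WellFormed.special⇒small (All.lookup wellFormed ls)) refl
      noFitLone : ¬ x' + x ≤ 1ℚ
      noFitLone = All.lookup noFit ls ∘ fits-lone {x} {x'}

Tagged : ℕ → ℕ → Config → Set
Tagged n r bs = Σ TConfig λ G → untag G ≡ bs × Invariant n r G

all-untag : ∀ {P : Bin → Set} G → (∀ k → P (lookup (untag G) k)) → All (P ∘ sizes) G
all-untag []      _ = []
all-untag {P} (B ∷ G) h = h zero ∷ all-untag {P} G (λ k → h (suc k))

locate : (G : TConfig) (j : Fin (length (untag G))) →
  Σ TConfig λ Gpre → Σ TBin λ B → Σ TConfig λ Gpost →
    G ≡ Gpre ++ B ∷ Gpost × lookup (untag G) j ≡ sizes B ×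
    (∀ i → putInto (untag G) j (size i) ≡ untag (Gpre ++ (i ∷ B) ∷ Gpost))
locate (B ∷ G) zero    = [] , B , G , refl , refl , λ _ → refl
locate (C ∷ G) (suc j) with locate G j
... | Gpre , B , Gpost , refl , lookup≡ , put≡ =
  C ∷ Gpre , B , Gpost , refl , lookup≡ , λ i → cong (sizes C ∷_) (put≡ i)

untag-snoc : ∀ G i → untag (G ++ [ i ∷ [] ]) ≡ openNew (untag G) (size i)
untag-snoc G i = map-++ sizes G [ i ∷ [] ]

step-special : ∀ {n r x G bs'} → x ≤ ½ → InUnit x → SpecialPhase n r →
  SpecialStep x (untag G) bs' → Invariant n r G → Tagged n (suc r) bs'
step-special {x = x} {G} x≤½ (0≤x , _) sp (sp-into j big fits) inv with locate G j
... | Gpre , B , Gpost , refl , lookup≡ , put≡ =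
  _ , sym (put≡ (item x true)) ,
  Into.special-into Gpre B Gpost inv x≤½ 0≤x sp
    (AnyP.map⁻ (subst HasBig lookup≡ big)) (subst (Fits x) lookup≡ fits)
step-special {x = x} {G} x≤½ x∈[0,1] sp (sp-new bigBlocks) inv =
  _ , untag-snoc G (item x true) ,
  Open.special-open G inv x≤½ x∈[0,1] sp
    (All.map (λ blocks big → blocks (AnyP.map⁺ big))
             (all-untag {λ b → HasBig b → ¬ Fits x b} G bigBlocks))

step-ordinary : ∀ {n r r' x G bs'} → OrdinaryArrival n r x r' → InUnit x →
  BFStep x (untag G) bs' → Invariant n r G → Tagged n r' bs'
step-ordinary {x = x} {G} arrival (0≤x , _) (bf-into j fits fullest) inv with locate G j
... | Gpre , B , Gpost , refl , lookup≡ , put≡ =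
  _ , sym (put≡ (item x false)) ,
  Into.ordinary-into Gpre B Gpost inv arrival 0≤x (subst (Fits x) lookup≡ fits)
    (subst (λ b → All (λ C → Fits x (sizes C) → load (sizes C) ≤ load b) (Gpre ++ B ∷ Gpost))
           lookup≡
      (all-untag {λ c → Fits x c → load c ≤ load (lookup (untag (Gpre ++ B ∷ Gpost)) j)} _ fullest))
step-ordinary {x = x} {G} arrival x∈[0,1] (bf-new noFit) inv =
  _ , untag-snoc G (item x false) ,
  Open.ordinary-open G inv arrival x∈[0,1] (all-untag {λ c → ¬ Fits x c} G noFit)

run : ∀ {n r xs bs bs'} → DBFRun n r xs bs bs' → Tagged n r bs → All InUnit xs →
  Σ ℕ λ r' → Tagged n r' bs'
run done tagged _ = _ , tagged
run (special x≤½ sp step rest) (G , refl , inv) (u ∷ us) =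
  run rest (step-special x≤½ u sp step inv) us
run (small x≤½ late step rest) (G , refl , inv) (u ∷ us) =
  run rest (step-ordinary (small x≤½ late) u step inv) us
run (large x≰½ step rest) (G , refl , inv) (u ∷ us) =
  run rest (step-ordinary (large x≰½) u step inv) us

-- Bounding the number of bins

total : (ℚ → ℕ) → Config → ℕ
total g bs = sum (map (sum ∘ map g) bs)

total-putInto : ∀ g bs j x → total g (putInto bs j x) ≡ g x +ℕ total g bs
total-putInto g (b ∷ bs) zero    x = ℕP.+-assoc (g x) _ _
total-putInto g (b ∷ bs) (suc j) x =
  trans (cong (sum (map g b) +ℕ_) (total-putInto g bs j x)) (x∙yz≈y∙xz (sum (map g b)) (g x) _)

total-openNew : ∀ g bs x → total g (openNew bs x) ≡ g x +ℕ total g bs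
total-openNew g []       x = cong (_+ℕ 0) (ℕP.+-identityʳ (g x))
total-openNew g (b ∷ bs) x =
  trans (cong (sum (map g b) +ℕ_) (total-openNew g bs x)) (x∙yz≈y∙xz (sum (map g b)) (g x) _)

total-special : ∀ g {x bs bs'} → SpecialStep x bs bs' → total g bs' ≡ g x +ℕ total g bs
total-special g {x} {bs} (sp-into j _ _) = total-putInto g bs j x
total-special g {x} {bs} (sp-new _)      = total-openNew g bs x

total-bestFit : ∀ g {x bs bs'} → BFStep x bs bs' → total g bs' ≡ g x +ℕ total g bs
total-bestFit g {x} {bs} (bf-into j _ _) = total-putInto g bs j x
total-bestFit g {x} {bs} (bf-new _)      = total-openNew g bs x

private
  after-step : ∀ t a {s t' t''} → t' ≡ a +ℕ t → t'' ≡ t' +ℕ s → t'' ≡ t +ℕ (a +ℕ s)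
  after-step t a refl refl = xy∙z≈y∙xz a t _

total-run : ∀ g {n r xs bs bs'} → DBFRun n r xs bs bs' → total g bs' ≡ total g bs +ℕ sum (map g xs)
total-run g done                    = sym (ℕP.+-identityʳ _)
total-run g {bs = bs} (special {x = x} _ _ step rest) =
  after-step (total g bs) (g x) (total-special g step) (total-run g rest)
total-run g {bs = bs} (small {x = x} _ _ step rest) =
  after-step (total g bs) (g x) (total-bestFit g step) (total-run g rest)
total-run g {bs = bs} (large {x = x} _ step rest) =
  after-step (total g bs) (g x) (total-bestFit g step) (total-run g rest)

sum-map-+ : ∀ {A : Set} (f g : A → ℕ) xs →
  sum (map (λ x → f x +ℕ g x) xs) ≡ sum (map f xs) +ℕ sum (map g xs)
sum-map-+ f g []       = refl
sum-map-+ f g (x ∷ xs) = trans (cong (f x +ℕ g x +ℕ_) (sum-map-+ f g xs)) (interchange (f x) (g x) _ _)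

count-+ : ∀ f g G → count (λ i → f i +ℕ g i) G ≡ count f G +ℕ count g G
count-+ f g G = trans (cong sum (map-cong (sum-map-+ f g) G)) (sum-map-+ (binWeight f) (binWeight g) G)

count-cong : ∀ {f g} → (∀ i → f i ≡ g i) → ∀ G → count f G ≡ count g G
count-cong f≗g G = cong sum (map-cong (λ B → cong sum (map-cong f≗g B)) G)

count-size : ∀ g G → count (g ∘ size) G ≡ total g (untag G)
count-size g G = cong sum (trans (map-cong (λ B → cong sum (map-∘ B)) G) (map-∘ G))

∈⇒≤binWeight : ∀ w {i B} → i ∈ B → w i ≤ℕ binWeight w B
∈⇒≤binWeight w (here refl)  = ℕP.m≤m+n _ _
∈⇒≤binWeight w {B = j ∷ _} (there i∈B) =
  ℕP.≤-trans (∈⇒≤binWeight w i∈B) (ℕP.m≤n+m _ (w j))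

*length≤count : ∀ {k w G} → All (λ B → k ≤ℕ binWeight w B) G → k *ℕ length G ≤ℕ count w G
*length≤count {k} []                 = ℕP.≤-reflexive (ℕP.*-zeroʳ k)
*length≤count {k} {G = _ ∷ G} (b ∷ bs) =
  ℕP.≤-trans (ℕP.≤-reflexive (ℕP.*-suc k (length G))) (ℕP.+-mono-≤ b (*length≤count bs))

loneSize : TBin → List ℚ
loneSize (item x true ∷ []) = x ∷ []
loneSize _                  = []

loneSizes : TConfig → List ℚ
loneSizes []      = []
loneSizes (B ∷ G) = loneSize B ++ loneSizes G

lone∈⇒∈loneSizes : ∀ {x G} → lone x ∈ G → x ∈ loneSizes G
lone∈⇒∈loneSizes (here refl)          = here refl
lone∈⇒∈loneSizes {G = B ∷ _} (there ls) = ∈-++⁺ʳ (loneSize B) (lone∈⇒∈loneSizes ls)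

∈loneSize⇒lone : ∀ {x B} → x ∈ loneSize B → B ≡ lone x
∈loneSize⇒lone {B = item _ true ∷ []} (here refl) = refl
∈loneSize⇒lone {B = item _ true ∷ []} (there ())

∈loneSizes⇒lone∈ : ∀ {x G} → x ∈ loneSizes G → lone x ∈ G
∈loneSizes⇒lone∈ {G = B ∷ G} x∈ with ∈-++⁻ (loneSize B) x∈
... | inj₁ x∈B = here (sym (∈loneSize⇒lone x∈B))
... | inj₂ x∈G = there (∈loneSizes⇒lone∈ x∈G)

minimal-lone : ∀ {x G} → lone x ∈ G →
  Σ ℚ λ x₀ → lone x₀ ∈ G × (∀ {y} → lone y ∈ G → x₀ ≤ y)
minimal-lone {x} {G} ls =
  min x (loneSizes G) , min-lone , λ ly → All.lookup (min≤xs x (loneSizes G)) (lone∈⇒∈loneSizes ly)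
  where
  min-lone : lone (min x (loneSizes G)) ∈ G
  min-lone = [ (λ min≡x → subst (λ z → lone z ∈ G) (sym min≡x) ls) , ∈loneSizes⇒lone∈ ]′
               (argmin-sel (λ z → z) x (loneSizes G))

-- x₀ will be the smallest lone special item.
smallWeight bigWeight weight : ℚ → ℚ → ℕ
smallWeight x₀ c = if does (x₀ ≤? c) then 1 else 0
bigWeight   x₀ c = if does (x₀ + c ≤? 1ℚ) then 1 else 2
weight      x₀ c = if does (c ≤? ½) then smallWeight x₀ c else bigWeight x₀ c

smallWeight≤1 : ∀ x₀ c → smallWeight x₀ c ≤ℕ 1
smallWeight≤1 x₀ c = if-elim {Q = _≤ℕ 1} (x₀ ≤? c) ℕP.≤-refl z≤n

bigWeight+smallWeight≤2 : ∀ x₀ a b → a + b ≤ 1ℚ →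
  bigWeight x₀ a +ℕ smallWeight x₀ b ≤ℕ 2
bigWeight+smallWeight≤2 x₀ a b a+b≤1 = cases (x₀ + a ≤? 1ℚ) (x₀ ≤? b)
  where
  cases : (d : Dec (x₀ + a ≤ 1ℚ)) (e : Dec (x₀ ≤ b)) →
          (if does d then 1 else 2) +ℕ (if does e then 1 else 0) ≤ℕ 2
  cases (yes _) e = s≤s (if-elim {Q = _≤ℕ 1} e ℕP.≤-refl z≤n)
  cases (no _) (no _) = ℕP.≤-refl
  cases (no x₀+a≰1) (yes x₀≤b) =
    ⊥-elim (x₀+a≰1 (ℚP.≤-trans (ℚP.+-monoˡ-≤ a x₀≤b)
                               (subst (_≤ 1ℚ) (ℚP.+-comm a b) a+b≤1)))

weight-pairBound : ∀ x₀ → PairBound 2 (weight x₀)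
weight-pairBound x₀ = record { single = single ; pair = pair }
  where
  single : ∀ c → weight x₀ c ≤ℕ 2
  single c = if-elim {Q = _≤ℕ 2} (c ≤? ½)
    (ℕP.≤-trans (smallWeight≤1 x₀ c) (ℕP.n≤1+n 1))
    (if-elim {Q = _≤ℕ 2} (x₀ + c ≤? 1ℚ) (ℕP.n≤1+n 1) ℕP.≤-refl)
  cases : ∀ a b → a + b ≤ 1ℚ → (d : Dec (a ≤ ½)) (e : Dec (b ≤ ½)) →
          (if does d then smallWeight x₀ a else bigWeight x₀ a) +ℕ
          (if does e then smallWeight x₀ b else bigWeight x₀ b) ≤ℕ 2
  cases a b a+b≤1 (yes _) (yes _) = ℕP.+-mono-≤ (smallWeight≤1 x₀ a) (smallWeight≤1 x₀ b)
  cases a b a+b≤1 (no _)  (yes _) = bigWeight+smallWeight≤2 x₀ a b a+b≤1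
  cases a b a+b≤1 (yes _) (no _)  = subst (_≤ℕ 2) (ℕP.+-comm (bigWeight x₀ b) _)
    (bigWeight+smallWeight≤2 x₀ b a (subst (_≤ 1ℚ) (ℚP.+-comm a b) a+b≤1))
  cases a b a+b≤1 (no a≰½) (no b≰½) = ⊥-elim (big+big≰1 a≰½ b≰½ a+b≤1)
  pair : ∀ a b → a + b ≤ 1ℚ → weight x₀ a +ℕ weight x₀ b ≤ℕ 2
  pair a b a+b≤1 = cases a b a+b≤1 (a ≤? ½) (b ≤? ½)

weight-smallAbove : ∀ {x₀ c} → c ≤ ½ → x₀ ≤ c → weight x₀ c ≡ 1
weight-smallAbove {x₀} {c} c≤½ x₀≤c = trans (if-yes (c ≤? ½) c≤½) (if-yes (x₀ ≤? c) x₀≤c)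

weight-big : ∀ {x₀ c} → ½ < c → 1 ≤ℕ weight x₀ c
weight-big {x₀} {c} c>½ = subst (1 ≤ℕ_) (sym (if-no (c ≤? ½) (<⇒≱ c>½)))
  (if-elim {Q = 1 ≤ℕ_} (x₀ + c ≤? 1ℚ) ℕP.≤-refl (ℕP.n≤1+n 1))

weight-overflow : ∀ {x₀ c} → ½ < c → ¬ x₀ + c ≤ 1ℚ → weight x₀ c ≡ 2
weight-overflow {x₀} {c} c>½ overflow =
  trans (if-no (c ≤? ½) (<⇒≱ c>½)) (if-no (x₀ + c ≤? 1ℚ) overflow)

bigI-pairBound : PairBound 1 bigI
bigI-pairBound = record
  { single = λ c → if-elim {Q = _≤ℕ 1} (c ≤? ½) z≤n ℕP.≤-refl
  ; pair   = pair
  }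
  where
  cases : ∀ {a b} → a + b ≤ 1ℚ → (d : Dec (a ≤ ½)) (e : Dec (b ≤ ½)) →
          (if does d then 0 else 1) +ℕ (if does e then 0 else 1) ≤ℕ 1
  cases _ (yes _) e = if-elim {Q = _≤ℕ 1} e z≤n ℕP.≤-refl
  cases _ (no _) (yes _) = ℕP.≤-refl
  cases a+b≤1 (no a≰½) (no b≰½) = ⊥-elim (big+big≰1 a≰½ b≰½ a+b≤1)
  pair : ∀ a b → a + b ≤ 1ℚ → bigI a +ℕ bigI b ≤ℕ 1
  pair a b a+b≤1 = cases a+b≤1 (a ≤? ½) (b ≤? ½)

one-pairBound : PairBound 2 (λ _ → 1)
one-pairBound = record { single = λ _ → ℕP.n≤1+n 1 ; pair = λ _ _ _ → ℕP.≤-refl }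

any⇒1≤binWeight : ∀ {P : Item → Set} w {B} → (∀ {i} → P i → 1 ≤ℕ w i) → Any P B →
                  1 ≤ℕ binWeight w B
any⇒1≤binWeight w 1≤w any with find any
... | i , i∈B , p = ℕP.≤-trans (1≤w p) (∈⇒≤binWeight w i∈B)

ordinary⇒1≤ordinaryI : ∀ {i} → Ordinary i → 1 ≤ℕ ordinaryI i
ordinary⇒1≤ordinaryI ord = subst (λ t → 1 ≤ℕ (if t then 0 else 1)) (sym ord) ℕP.≤-refl

special⇒1≤specialI : ∀ {i} → Special i → 1 ≤ℕ specialI i
special⇒1≤specialI sp = subst (λ t → 1 ≤ℕ (if t then 1 else 0)) (sym sp) ℕP.≤-refl

module Analysis {n r : ℕ} {G : TConfig} (inv : Invariant n r G) where

  open Invariant inv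

  bins≤ordinaries : (∀ {x} → ¬ lone x ∈ G) → length G ≤ℕ count ordinaryI G
  bins≤ordinaries noLone = subst (_≤ℕ count ordinaryI G) (ℕP.*-identityˡ (length G))
    (*length≤count (All.tabulate (λ B∈G → hasOrdinary B∈G (All.lookup wellFormed B∈G))))
    where
    hasOrdinary : ∀ {B} → B ∈ G → WellFormed n r B → 1 ≤ℕ binWeight ordinaryI B
    hasOrdinary {[]}                 _   wf = ⊥-elim (WellFormed.nonEmpty wf refl)
    hasOrdinary {item _ true ∷ []}  B∈G _  = ⊥-elim (noLone B∈G)
    hasOrdinary {item _ false ∷ []} _   _  = ℕP.≤-refl
    hasOrdinary {_ ∷ _ ∷ _}         _   wf =
      any⇒1≤binWeight ordinaryI (λ {i} → ordinary⇒1≤ordinaryI {i})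
        (WellFormed.shared⇒ordinary wf (s≤s (s≤s z≤n)))

  module _ {x₀ : ℚ} (lone₀ : lone x₀ ∈ G) (minimal : ∀ {y} → lone y ∈ G → x₀ ≤ y) where

    private
      w : Item → ℕ
      w i = weight x₀ (size i) +ℕ specialI i

    specialAbove⇒2≤w : ∀ {o} → Small o → ¬ OrdinarySmall o → x₀ ≤ size o → 2 ≤ℕ w o
    specialAbove⇒2≤w {item c true}  c≤½ _   x₀≤c =
      ℕP.≤-reflexive (sym (cong (_+ℕ 1) (weight-smallAbove c≤½ x₀≤c)))
    specialAbove⇒2≤w {item c false} c≤½ ¬os _    = ⊥-elim (¬os (refl , c≤½))

    smallBin : ∀ {B} → B ∈ G → WellFormed n r B → Compatible x₀ B → All Small B →
               2 ≤ℕ binWeight w B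
    smallBin {[]} _ wf _ _ = ⊥-elim (WellFormed.nonEmpty wf refl)
    smallBin {item c true ∷ []} B∈G _ _ (c≤½ ∷ []) =
      ℕP.≤-trans (specialAbove⇒2≤w c≤½ (λ ()) (minimal B∈G)) (ℕP.m≤m+n _ 0)
    smallBin {item c false ∷ []} _ _ cp (c≤½ ∷ []) =
      ⊥-elim (opened-singleton (Compatible.opener-notOrdinarySmall cp) (refl , c≤½))
    smallBin {_ ∷ _ ∷ _} _ _ cp allSmall
      with find (Any-∩ allSmall (opened⇒any (zipOpened opener-notOrdinarySmall
                                                       (opener-≥ allSmall (s≤s (s≤s z≤n))))))
      where open Compatible cp
    ... | o , o∈B , o≤½ , ¬os , x₀≤o =
      ℕP.≤-trans (specialAbove⇒2≤w o≤½ ¬os x₀≤o) (∈⇒≤binWeight w o∈B)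

    -- A big item weighs 2 unless x₀ fits beside it, and then the bin holds a special item.
    bigBin : ∀ {B} → Compatible x₀ B → Any Big B → 2 ≤ℕ binWeight w B
    bigBin {B} cp someBig with find someBig
    ... | Y , Y∈B , Y>½ with x₀ + size Y ≤? 1ℚ
    ...   | no overflow =
      ℕP.≤-trans (ℕP.≤-reflexive (sym (weight-overflow {x₀} Y>½ overflow)))
                 (ℕP.≤-trans (ℕP.m≤m+n _ (specialI Y)) (∈⇒≤binWeight w Y∈B))
    ...   | yes fits = subst (2 ≤ℕ_) (sym (sum-map-+ (weight x₀ ∘ size) specialI B))
      (ℕP.+-mono-≤ (any⇒1≤binWeight (weight x₀ ∘ size) (λ {i} → weight-big {x₀} {size i})
                                    someBig)
                   (any⇒1≤binWeight specialI (λ {i} → special⇒1≤specialI {i})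
                     (Compatible.bigFitting⇒special cp (lose Y∈B (Y>½ , fits)))))

    2*bins≤weights : 2 *ℕ length G ≤ℕ count (weight x₀ ∘ size) G +ℕ count specialI G
    2*bins≤weights = subst (2 *ℕ length G ≤ℕ_) (count-+ (weight x₀ ∘ size) specialI G)
      (*length≤count (All.tabulate perBin))
      where
      perBin : ∀ {B} → B ∈ G → 2 ≤ℕ binWeight w B
      perBin {B} B∈G with All.search (λ i → ½ <? size i) B
      ... | inj₁ noBig  = smallBin B∈G (All.lookup wellFormed B∈G) (All.lookup (compatible lone₀) B∈G)
                                   (All.map ℚP.≮⇒≥ noBig)
      ... | inj₂ someBig = bigBin (All.lookup (compatible lone₀) B∈G) someBig

lone? : ∀ G → (∀ {x} → ¬ lone x ∈ G) ⊎ Σ ℚ λ x → lone x ∈ G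
lone? G with loneSizes G in sizes≡
... | []    = inj₁ (λ ls → case subst (_ ∈_) sizes≡ (lone∈⇒∈loneSizes ls) of λ ())
... | x ∷ _ = inj₂ (x , ∈loneSizes⇒lone∈ (subst (x ∈_) (sym sizes≡) (here refl)))

sum-ones : ∀ (xs : List ℚ) → sum (map (λ _ → 1) xs) ≡ length xs
sum-ones []       = refl
sum-ones (_ ∷ xs) = cong suc (sum-ones xs)

ordinaryI+specialI≡1 : ∀ i → ordinaryI i +ℕ specialI i ≡ 1
ordinaryI+specialI≡1 (item _ true)  = refl
ordinaryI+specialI≡1 (item _ false) = refl

bigI+smallI≡1 : ∀ c → bigI c +ℕ smallI c ≡ 1
bigI+smallI≡1 c with does (c ≤? ½)
... | true  = refl
... | false = refl

three-halves : ∀ {b W S n opt} → 2 *ℕ b ≤ℕ W +ℕ S → W ≤ℕ opt *ℕ 2 → 3 *ℕ S ≤ℕ n →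
  n ≤ℕ opt *ℕ 2 → 3 *ℕ b ≤ℕ 4 *ℕ opt
three-halves {b} {W} {S} {n} {opt} 2b≤W+S W≤2opt 3S≤n n≤2opt = ℕP.*-cancelˡ-≤ 2 (begin
  2 *ℕ (3 *ℕ b)               ≡⟨ solve (b L.∷ L.[]) ⟩
  3 *ℕ (2 *ℕ b)               ≤⟨ ℕP.*-monoʳ-≤ 3 2b≤W+S ⟩
  3 *ℕ (W +ℕ S)               ≡⟨ ℕP.*-distribˡ-+ 3 W S ⟩
  3 *ℕ W +ℕ 3 *ℕ S            ≤⟨ ℕP.+-mono-≤ (ℕP.*-monoʳ-≤ 3 W≤2opt) (ℕP.≤-trans 3S≤n n≤2opt) ⟩
  3 *ℕ (opt *ℕ 2) +ℕ opt *ℕ 2 ≡⟨ solve (opt L.∷ L.[]) ⟩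
  2 *ℕ (4 *ℕ opt)             ∎)
  where open ℕP.≤-Reasoning

<3*suc⇒≤3*+2 : ∀ {n s} → n <ℕ 3 *ℕ suc s → n ≤ℕ 3 *ℕ s +ℕ 2
<3*suc⇒≤3*+2 {s = s} n<3[1+s] =
  ℕP.≤-pred (ℕP.≤-trans n<3[1+s] (ℕP.≤-reflexive (solve (s L.∷ L.[]))))

-- Either all items of size at most ½ are special, and then the ordinary items are the
-- big ones, or at least a third of all items are special.
ordinaries-bound : ∀ {O S n r Bg opt} → O +ℕ S ≡ n → Bg +ℕ r ≡ n → Bg ≤ℕ opt →
  n ≤ℕ opt *ℕ 2 → S ≡ r ⊎ n <ℕ 3 *ℕ suc S → 3 *ℕ O ≤ℕ 4 *ℕ opt +ℕ 3
ordinaries-bound {O} {S} {Bg = Bg} {opt} O+S≡n Bg+S≡n Bg≤opt _ (inj₁ refl) = begin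
  3 *ℕ O           ≡⟨ cong (3 *ℕ_) (ℕP.+-cancelʳ-≡ S O Bg (trans O+S≡n (sym Bg+S≡n))) ⟩
  3 *ℕ Bg          ≤⟨ ℕP.*-monoʳ-≤ 3 Bg≤opt ⟩
  3 *ℕ opt         ≤⟨ ℕP.*-monoˡ-≤ opt (ℕP.n≤1+n 3) ⟩
  4 *ℕ opt         ≤⟨ ℕP.m≤m+n (4 *ℕ opt) 3 ⟩
  4 *ℕ opt +ℕ 3    ∎
  where open ℕP.≤-Reasoning
ordinaries-bound {O} {S} {n} {opt = opt} O+S≡n _ _ n≤2opt (inj₂ n<3[1+S]) = begin
  3 *ℕ O               ≤⟨ ℕP.+-cancelʳ-≤ n (3 *ℕ O) (2 *ℕ n +ℕ 2) 3O+n≤2n+2+n ⟩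
  2 *ℕ n +ℕ 2          ≤⟨ ℕP.+-monoˡ-≤ 2 (ℕP.*-monoʳ-≤ 2 n≤2opt) ⟩
  2 *ℕ (opt *ℕ 2) +ℕ 2 ≡⟨ solve (opt L.∷ L.[]) ⟩
  4 *ℕ opt +ℕ 2        ≤⟨ ℕP.+-monoʳ-≤ (4 *ℕ opt) (ℕP.n≤1+n 2) ⟩
  4 *ℕ opt +ℕ 3        ∎
  where
  open ℕP.≤-Reasoning
  3O+n≤2n+2+n : 3 *ℕ O +ℕ n ≤ℕ (2 *ℕ n +ℕ 2) +ℕ n
  3O+n≤2n+2+n = begin
    3 *ℕ O +ℕ n             ≤⟨ ℕP.+-monoʳ-≤ (3 *ℕ O) (<3*suc⇒≤3*+2 n<3[1+S]) ⟩
    3 *ℕ O +ℕ (3 *ℕ S +ℕ 2) ≡⟨ solve (O L.∷ S L.∷ L.[]) ⟩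
    3 *ℕ (O +ℕ S) +ℕ 2      ≡⟨ cong (λ m → 3 *ℕ m +ℕ 2) O+S≡n ⟩
    3 *ℕ n +ℕ 2             ≡⟨ solve (n L.∷ L.[]) ⟩
    (2 *ℕ n +ℕ 2) +ℕ n      ∎

admissible⇒inUnit : ∀ {δ e c} → δ ≤ 1ℚ → 0ℚ < e → Admissible δ e c → InUnit c
admissible⇒inUnit {δ} {e} δ≤1 0<e (lower , upper) =
  ℚP.≤-trans 0≤e[1-δ] lower , ℚP.≤-trans upper (ℚP.p⊓q≤q (e * (1ℚ + δ)) 1ℚ)
  where
  instance
    1-δ-nonNeg : NonNegative (1ℚ - δ)
    1-δ-nonNeg = nonNegative (subst (_≤ 1ℚ - δ) (ℚP.+-inverseʳ δ) (ℚP.+-monoˡ-≤ (- δ) δ≤1))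
  0≤e[1-δ] : 0ℚ ≤ e * (1ℚ - δ)
  0≤e[1-δ] = subst (_≤ e * (1ℚ - δ)) (ℚP.*-zeroˡ (1ℚ - δ))
                   (ℚP.*-monoʳ-≤-nonNeg (1ℚ - δ) (ℚP.<⇒≤ 0<e))

admissible⇒inUnit* : ∀ {δ est cs} → δ ≤ 1ℚ → All (λ e → (0ℚ < e) × (e ≤ 1ℚ)) est →
  Pointwise (Admissible δ) est cs → All InUnit cs
admissible⇒inUnit* δ≤1 []                []       = []
admissible⇒inUnit* δ≤1 ((0<e , _) ∷ es) (a ∷ as) =
  admissible⇒inUnit δ≤1 0<e a ∷ admissible⇒inUnit* δ≤1 es as

DBF≤4/3·OPT : ∀ {cs bs opt} → All InUnit cs → NoThreeFit cs → DBF-Run cs bs → Packable cs opt →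
  3 *ℕ length bs ≤ℕ 4 *ℕ opt +ℕ 3
DBF≤4/3·OPT {cs} {bs} {opt} inUnit noThree dbf packing
  with run dbf ([] , refl , invariant-empty (length cs)) inUnit
... | r , G , refl , inv = subst (λ b → 3 *ℕ b ≤ℕ 4 *ℕ opt +ℕ 3) (sym (length-map sizes G)) bound
  where
  open Invariant inv
  n = length cs
  items : ∀ g → count (g ∘ size) G ≡ sum (map g cs)
  items g = trans (count-size g G) (total-run g dbf)
  packed : ∀ {H g} → PairBound H g → count (g ∘ size) G ≤ℕ opt *ℕ H
  packed {g = g} pb =
    subst (_≤ℕ _) (sym (items g)) (weights≤packing (All.map proj₁ inUnit) noThree pb packing)
  n-items : count (λ _ → 1) G ≡ n
  n-items = trans (items (λ _ → 1)) (sum-ones cs)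
  split-items : ∀ {f g} → (∀ i → f i +ℕ g i ≡ 1) → count f G +ℕ count g G ≡ n
  split-items f+g≡1 = trans (sym (count-+ _ _ G)) (trans (count-cong f+g≡1 G) n-items)
  n≤2opt : n ≤ℕ opt *ℕ 2
  n≤2opt = subst (_≤ℕ opt *ℕ 2) n-items (packed one-pairBound)
  bound : 3 *ℕ length G ≤ℕ 4 *ℕ opt +ℕ 3
  bound with lone? G
  ... | inj₁ noLone = ℕP.≤-trans (ℕP.*-monoʳ-≤ 3 (Analysis.bins≤ordinaries inv noLone))
    (ordinaries-bound (split-items ordinaryI+specialI≡1)
      (subst (λ s → count (bigI ∘ size) G +ℕ s ≡ n) smalls (split-items (bigI+smallI≡1 ∘ size)))
      (ℕP.≤-trans (packed bigI-pairBound) (ℕP.≤-reflexive (ℕP.*-identityʳ opt))) n≤2opt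
      (PhaseCount.saturated specials))
  ... | inj₂ (_ , ls) with minimal-lone ls
  ...   | x₀ , lone₀ , minimal = ℕP.≤-trans
    (three-halves {b = length G} {opt = opt} (Analysis.2*bins≤weights inv lone₀ minimal)
                  (packed (weight-pairBound x₀)) (PhaseCount.3s≤n specials) n≤2opt)
    (ℕP.m≤m+n (4 *ℕ opt) 3)

theorem4 : (δ : ℚ) → 0ℚ < δ → δ ≤ 1ℚ →
    Σ ℕ λ K →
    (est cs : List ℚ) →
    All (λ e → (0ℚ < e) × (e ≤ 1ℚ)) est →
    Pointwise (Admissible δ) est cs →
    NoThreeFit cs →
    (bs : Config) → DBF-Run cs bs →
    (opt : ℕ) → IsOPT cs opt →
    3 *ℕ length bs ≤ℕ 4 *ℕ opt +ℕ 3 *ℕ K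
theorem4 δ _ δ≤1 = 1 , λ _ _ estimates admissible noThree _ dbf _ (packing , _) →
  DBF≤4/3·OPT (admissible⇒inUnit* δ≤1 estimates admissible) noThree dbf packing
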